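{- Let $n\geq 2$ be an integer, let $s\geq 2$, and let $e_1,\ldots,e_s$ be positive integers with $\sum_{i=1}^s e_i=n$. If $\prod_{i=1}^s(2^{e_i}-1)$ divides $2^n-1$, then $e_i\mid n$ for all $1\leq i\leq s$, and $\gcd(e_1,\ldots,e_s)=1$. -}

module Defs where

open import Data.Nat using (ℕ; _+_; _*_; _∸_; _^_)
open import Data.Nat.GCD using (gcd)
open import Data.Fin using (Fin)
open import Data.Vec.Functional using (foldr)

sumF : ∀ {s} → (Fin s → ℕ) → ℕ
sumF e = foldr _+_ 0 e

prodF : ∀ {s} → (Fin s → ℕ) → ℕ
prodF e = foldr _*_ 1 e

gcdF : ∀ {s} → (Fin s → ℕ) → ℕ
gcdF e = foldr gcd 0 e

mersenne : ℕ → ℕ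
mersenne k = 2 ^ k ∸ 1

{-# OPTIONS --safe #-}
-- Each 2^eᵢ − 1 divides 2^n − 1, and 2^e − 1 ∣ 2^n − 1 forces e ∣ n (reduce n modulo e).
-- Suppose every eᵢ is divisible by some d ≥ 2, and let w = 2^d − 1: it is odd, at least 3,
-- and divides every 2^eᵢ − 1. Let e be the largest eᵢ and n = t e, so that t ≤ s. Then
-- 2^n − 1 = (2^e − 1)(1 + z + ⋯ + z^(t−1)) with z = 2^e ≡ 1 (mod w), so w^(s−1) divides
-- the geometric sum. For odd w, lifting the exponent shows that w^k dividing this sum forces
-- w^k ∣ t: the sum is ≡ t (mod w), and a sum of w consecutive powers of z is w times a number
-- ≡ 1 (mod w). Hence 3^(s−1) ≤ w^(s−1) ≤ t ≤ s, which is impossible for s ≥ 2.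
module Submission where

open import Data.Fin using (Fin; zero; suc)
open import Data.Nat
open import Data.Nat.DivMod using (_%_; _/_; m≡m%n+[m/n]*n; m%n<n; m<n⇒m%n≡m)
open import Data.Nat.Divisibility
open import Data.Nat.GCD using (gcd[m,n]∣m; gcd[m,n]∣n)
open import Data.Nat.Properties
open import Data.Nat.Tactic.RingSolver using (solve-∀)
open import Data.Product using (∃-syntax; _×_; _,_; proj₁; proj₂)
open import Data.Sum using ([_,_]′; inj₁; inj₂)
open import Function using (id; _∘_)
open import Relation.Binary.PropositionalEquality
open import Relation.Nullary using (¬_; contradiction)
open import Defs

open ≡-Reasoning

geomSum : ℕ → ℕ → ℕ
geomSum z zero    = 0
geomSum z (suc t) = 1 + z * geomSum z t

geomSum-closedForm : ∀ m t → geomSum (suc m) t * m + 1 ≡ suc m ^ t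
geomSum-closedForm m zero    = refl
geomSum-closedForm m (suc t) = begin
  (1 + suc m * g) * m + 1  ≡⟨ identity m g ⟩
  suc m * (g * m + 1)      ≡⟨ cong (suc m *_) (geomSum-closedForm m t) ⟩
  suc m * suc m ^ t        ∎
  where
  g : ℕ
  g = geomSum (suc m) t
  identity : ∀ m g → (1 + suc m * g) * m + 1 ≡ suc m * (g * m + 1)
  identity = solve-∀

geomSum-+ : ∀ z a b → geomSum z (a + b) ≡ geomSum z a + z ^ a * geomSum z b
geomSum-+ z zero    b = sym (+-identityʳ (geomSum z b))
geomSum-+ z (suc a) b = begin
  1 + z * geomSum z (a + b)                        ≡⟨ cong (λ x → 1 + z * x) (geomSum-+ z a b) ⟩
  1 + z * (geomSum z a + z ^ a * geomSum z b)      ≡⟨ identity z (geomSum z a) (z ^ a) (geomSum z b) ⟩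
  (1 + z * geomSum z a) + z * z ^ a * geomSum z b  ∎
  where
  identity : ∀ z g p h → 1 + z * (g + p * h) ≡ (1 + z * g) + z * p * h
  identity = solve-∀

geomSum-* : ∀ z a b → geomSum z (a * b) ≡ geomSum z a * geomSum (z ^ a) b
geomSum-* z a zero    = trans (cong (geomSum z) (*-zeroʳ a)) (sym (*-zeroʳ (geomSum z a)))
geomSum-* z a (suc b) = begin
  geomSum z (a * suc b)                          ≡⟨ cong (geomSum z) (*-suc a b) ⟩
  geomSum z (a + a * b)                          ≡⟨ geomSum-+ z a (a * b) ⟩
  geomSum z a + z ^ a * geomSum z (a * b)        ≡⟨ cong (λ x → geomSum z a + z ^ a * x) (geomSum-* z a b) ⟩
  g + z ^ a * (g * geomSum (z ^ a) b)            ≡⟨ identity g (z ^ a) (geomSum (z ^ a) b) ⟩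
  g * geomSum (z ^ a) (suc b)                    ∎
  where
  g : ℕ
  g = geomSum z a
  identity : ∀ g p h → g + p * (g * h) ≡ g * (1 + p * h)
  identity = solve-∀

^-≡1-mod : ∀ w c t → (1 + w * c) ^ t ≡ 1 + w * (c * geomSum (1 + w * c) t)
^-≡1-mod w c t = begin
  (1 + w * c) ^ t                ≡⟨ geomSum-closedForm (w * c) t ⟨
  g * (w * c) + 1                ≡⟨ identity w c g ⟩
  1 + w * (c * g)                ∎
  where
  g : ℕ
  g = geomSum (1 + w * c) t
  identity : ∀ w c g → g * (w * c) + 1 ≡ 1 + w * (c * g)
  identity = solve-∀

triangle : ℕ → ℕ
triangle zero    = 0
triangle (suc t) = t + triangle t

triangle-odd : ∀ h → triangle (suc (2 * h)) ≡ suc (2 * h) * h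
triangle-odd zero    = refl
triangle-odd (suc h) = begin
  triangle (suc (2 * suc h))                       ≡⟨ cong (triangle ∘ suc) (*-suc 2 h) ⟩
  suc (suc (2 * h)) + (suc (2 * h) + triangle (suc (2 * h)))
                                                   ≡⟨ cong (λ x → suc (suc (2 * h)) + (suc (2 * h) + x)) (triangle-odd h) ⟩
  suc (suc (2 * h)) + (suc (2 * h) + suc (2 * h) * h)
                                                   ≡⟨ identity h ⟩
  suc (2 + 2 * h) * suc h                          ≡⟨ cong (λ x → suc x * suc h) (*-suc 2 h) ⟨
  suc (2 * suc h) * suc h                          ∎
  where
  identity : ∀ h → suc (suc (2 * h)) + (suc (2 * h) + suc (2 * h) * h) ≡ suc (2 + 2 * h) * suc h
  identity = solve-∀

geomSum-mod-square : ∀ w c t → ∃[ q ] geomSum (1 + w * c) t ≡ t + w * c * triangle t + w * w * q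
geomSum-mod-square w c zero    = 0 , identity w c
  where
  identity : ∀ w c → 0 ≡ 0 + w * c * 0 + w * w * 0
  identity = solve-∀
geomSum-mod-square w c (suc t) with geomSum-mod-square w c t
... | q , eq = q + c * c * triangle t + w * c * q , (begin
  1 + (1 + w * c) * geomSum (1 + w * c) t                         ≡⟨ cong (λ x → 1 + (1 + w * c) * x) eq ⟩
  1 + (1 + w * c) * (t + w * c * triangle t + w * w * q)          ≡⟨ identity w c t (triangle t) q ⟩
  suc t + w * c * (t + triangle t) + w * w * (q + c * c * triangle t + w * c * q) ∎)
  where
  identity : ∀ w c t T q → 1 + (1 + w * c) * (t + w * c * T + w * w * q)
                         ≡ suc t + w * c * (t + T) + w * w * (q + c * c * T + w * c * q)
  identity = solve-∀

geomSum-mod : ∀ w c t → ∃[ q ] geomSum (1 + w * c) t ≡ t + w * q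
geomSum-mod w c t with geomSum-mod-square w c t
... | q , eq = c * triangle t + w * q , trans eq (identity w c t (triangle t) q)
  where
  identity : ∀ w c t T q → t + w * c * T + w * w * q ≡ t + w * (c * T + w * q)
  identity = solve-∀

∣-geomSum*unit⇒∣ : ∀ {w c r} t → w ∣ geomSum (1 + w * c) t * (1 + w * r) → w ∣ t
∣-geomSum*unit⇒∣ {w} {c} {r} t w∣ with geomSum-mod w c t
... | q , eq = ∣m+n∣m⇒∣n (subst (w ∣_) (trans (cong (_* (1 + w * r)) eq) (identity w r t q)) w∣) (m∣m*n _)
  where
  identity : ∀ w r t q → (t + w * q) * (1 + w * r) ≡ w * (q + r * t + q * w * r) + t
  identity = solve-∀

module OddModulus (h : ℕ) where

  w : ℕ
  w = suc (2 * h)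

  -- Oddness of w is used only here, through w ∣ triangle w.
  geomSum-w : ∀ c → ∃[ u ] geomSum (1 + w * c) w ≡ w * (1 + w * u)
  geomSum-w c with geomSum-mod-square w c w
  ... | q , eq = c * h + q , (begin
    geomSum (1 + w * c) w             ≡⟨ eq ⟩
    w + w * c * triangle w + w * w * q ≡⟨ cong (λ x → w + w * c * x + w * w * q) (triangle-odd h) ⟩
    w + w * c * (w * h) + w * w * q    ≡⟨ identity w c h q ⟩
    w * (1 + w * (c * h + q))          ∎)
    where
    identity : ∀ w c h q → w + w * c * (w * h) + w * w * q ≡ w * (1 + w * (c * h + q))
    identity = solve-∀

  geomSum-*w : ∀ c t r → ∃[ r′ ] geomSum (1 + w * c) (t * w) * (1 + w * r)
                                   ≡ w * (geomSum (1 + w * c) t * (1 + w * r′))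
  geomSum-*w c t r with geomSum-w (c * geomSum (1 + w * c) t)
  ... | u , eq = u + r + w * u * r , (begin
    geomSum z (t * w) * (1 + w * r)                      ≡⟨ cong (_* (1 + w * r)) (geomSum-* z t w) ⟩
    g * geomSum (z ^ t) w * (1 + w * r)                  ≡⟨ cong (λ x → g * geomSum x w * (1 + w * r)) (^-≡1-mod w c t) ⟩
    g * geomSum (1 + w * (c * g)) w * (1 + w * r)        ≡⟨ cong (λ x → g * x * (1 + w * r)) eq ⟩
    g * (w * (1 + w * u)) * (1 + w * r)                  ≡⟨ identity g w u r ⟩
    w * (g * (1 + w * (u + r + w * u * r)))              ∎)
    where
    z g : ℕ
    z = 1 + w * c
    g = geomSum z t
    identity : ∀ g w u r → g * (w * (1 + w * u)) * (1 + w * r) ≡ w * (g * (1 + w * (u + r + w * u * r)))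
    identity = solve-∀

  -- The factor 1 + w * r absorbs the unit 1 + w * u of geomSum-w, which makes the induction on k go through.
  ^-∣-geomSum*unit⇒^-∣ : ∀ k {c r} t → w ^ k ∣ geomSum (1 + w * c) t * (1 + w * r) → w ^ k ∣ t
  ^-∣-geomSum*unit⇒^-∣ zero          t _ = 1∣ t
  ^-∣-geomSum*unit⇒^-∣ (suc k) {c} {r} t w^[1+k]∣
    with divides-refl t′ ← ∣-geomSum*unit⇒∣ {w} t (∣-trans (m∣m*n (w ^ k)) w^[1+k]∣)
    with r′ , eq ← geomSum-*w c t′ r
    = subst (w ^ suc k ∣_) (*-comm w t′) (*-monoʳ-∣ w w^k∣t′)
    where
    w^k∣t′ : w ^ k ∣ t′
    w^k∣t′ = ^-∣-geomSum*unit⇒^-∣ k t′ (*-cancelˡ-∣ w (subst (w ^ suc k ∣_) eq w^[1+k]∣))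

  ^-∣-geomSum⇒^-∣ : ∀ k {c} t → w ^ k ∣ geomSum (1 + w * c) t → w ^ k ∣ t
  ^-∣-geomSum⇒^-∣ k {c} t w^k∣ = ^-∣-geomSum*unit⇒^-∣ k {r = 0} t (subst (w ^ k ∣_) unit≡1 w^k∣)
    where
    unit≡1 : geomSum (1 + w * c) t ≡ geomSum (1 + w * c) t * (1 + w * 0)
    unit≡1 = sym (trans (cong (λ x → geomSum (1 + w * c) t * (1 + x)) (*-zeroʳ w)) (*-identityʳ _))

1+mersenne≡2^ : ∀ k → 1 + mersenne k ≡ 2 ^ k
1+mersenne≡2^ k = m+[n∸m]≡n (m^n>0 2 k)

mersenne-suc : ∀ k → mersenne (suc k) ≡ suc (2 * mersenne k)
mersenne-suc k = suc-injective (begin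
  1 + mersenne (suc k)       ≡⟨ 1+mersenne≡2^ (suc k) ⟩
  2 * 2 ^ k                  ≡⟨ cong (2 *_) (1+mersenne≡2^ k) ⟨
  2 * (1 + mersenne k)       ≡⟨ *-distribˡ-+ 2 1 (mersenne k) ⟩
  suc (suc (2 * mersenne k)) ∎)

mersenne-+ : ∀ a b → mersenne (a + b) ≡ 2 ^ a * mersenne b + mersenne a
mersenne-+ a b = suc-injective (begin
  1 + mersenne (a + b)                  ≡⟨ 1+mersenne≡2^ (a + b) ⟩
  2 ^ (a + b)                           ≡⟨ ^-distribˡ-+-* 2 a b ⟩
  2 ^ a * 2 ^ b                         ≡⟨ cong (2 ^ a *_) (1+mersenne≡2^ b) ⟨
  2 ^ a * (1 + mersenne b)              ≡⟨ cong (λ x → x * (1 + mersenne b)) (1+mersenne≡2^ a) ⟨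
  (1 + mersenne a) * (1 + mersenne b)   ≡⟨ identity (mersenne a) (mersenne b) ⟩
  1 + ((1 + mersenne a) * mersenne b + mersenne a)
                                        ≡⟨ cong (λ x → 1 + (x * mersenne b + mersenne a)) (1+mersenne≡2^ a) ⟩
  1 + (2 ^ a * mersenne b + mersenne a) ∎)
  where
  identity : ∀ x y → (1 + x) * (1 + y) ≡ 1 + ((1 + x) * y + x)
  identity = solve-∀

mersenne-* : ∀ d a → mersenne (d * a) ≡ geomSum (1 + mersenne d) a * mersenne d
mersenne-* d a = suc-injective (begin
  1 + mersenne (d * a)                        ≡⟨ 1+mersenne≡2^ (d * a) ⟩
  2 ^ (d * a)                                 ≡⟨ ^-*-assoc 2 d a ⟨
  (2 ^ d) ^ a                                 ≡⟨ cong (_^ a) (1+mersenne≡2^ d) ⟨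
  (1 + mersenne d) ^ a                        ≡⟨ geomSum-closedForm (mersenne d) a ⟨
  geomSum (1 + mersenne d) a * mersenne d + 1 ≡⟨ +-comm _ 1 ⟩
  1 + geomSum (1 + mersenne d) a * mersenne d ∎)

mersenne-∣-mersenne : ∀ {d n} → d ∣ n → mersenne d ∣ mersenne n
mersenne-∣-mersenne {d} (divides-refl a) =
  divides (geomSum (1 + mersenne d) a) (trans (cong mersenne (*-comm a d)) (mersenne-* d a))

mersenne-mono-< : ∀ {a b} → a < b → mersenne a < mersenne b
mersenne-mono-< {a} {b} a<b =
  s<s⁻¹ (subst₂ _<_ (sym (1+mersenne≡2^ a)) (sym (1+mersenne≡2^ b)) (^-monoʳ-< 2 (s≤s (s≤s z≤n)) a<b))

mersenne-pos : ∀ {k} → 0 < k → 0 < mersenne k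
mersenne-pos = mersenne-mono-<

mersenne≡0⇒≡0 : ∀ {k} → mersenne k ≡ 0 → k ≡ 0
mersenne≡0⇒≡0 {k} eq =
  [ id , (λ ()) ]′ (m^n≡1⇒n≡0∨m≡1 2 k (trans (sym (1+mersenne≡2^ k)) (cong suc eq)))

mersenne-∣⇒∣ : ∀ {e n} → 0 < e → mersenne e ∣ mersenne n → e ∣ n
mersenne-∣⇒∣ {e@(suc _)} {n} 0<e M[e]∣M[n] = divides (n / e) (trans n≡r+qe (cong (_+ n / e * e) r≡0))
  where
  instance
    M[e]≢0 : NonZero (mersenne e)
    M[e]≢0 = >-nonZero (mersenne-pos 0<e)
  r : ℕ
  r = n % e
  n≡r+qe : n ≡ r + n / e * e
  n≡r+qe = m≡m%n+[m/n]*n n e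
  M[e]∣M[r] : mersenne e ∣ mersenne r
  M[e]∣M[r] = ∣m+n∣m⇒∣n
    (subst (mersenne e ∣_) (trans (cong mersenne n≡r+qe) (mersenne-+ r (n / e * e))) M[e]∣M[n])
    (∣-trans (mersenne-∣-mersenne (n∣m*n (n / e))) (n∣m*n (2 ^ r)))
  r≡0 : r ≡ 0
  r≡0 = mersenne≡0⇒≡0 (begin
    mersenne r                ≡⟨ m<n⇒m%n≡m (mersenne-mono-< (m%n<n n e)) ⟨
    mersenne r % mersenne e   ≡⟨ n∣m⇒m%n≡0 _ _ M[e]∣M[r] ⟩
    0                         ∎)

∣-prodF : ∀ {s} (f : Fin s → ℕ) i → f i ∣ prodF f
∣-prodF f zero    = m∣m*n _
∣-prodF f (suc i) = ∣-trans (∣-prodF (f ∘ suc) i) (n∣m*n (f zero))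

^-∣-prodF : ∀ {w s} (f : Fin s → ℕ) → (∀ i → w ∣ f i) → w ^ s ∣ prodF f
^-∣-prodF {s = zero}  f w∣f = ∣-refl
^-∣-prodF {s = suc s} f w∣f = *-pres-∣ (w∣f zero) (^-∣-prodF (f ∘ suc) (w∣f ∘ suc))

^-*-∣-prodF : ∀ {w s} (f : Fin (suc s) → ℕ) → (∀ i → w ∣ f i) → ∀ i → w ^ s * f i ∣ prodF f
^-*-∣-prodF {w} {s} f w∣f zero =
  subst (_∣ prodF f) (*-comm (f zero) (w ^ s)) (*-monoʳ-∣ (f zero) (^-∣-prodF (f ∘ suc) (w∣f ∘ suc)))
^-*-∣-prodF {w} {suc s} f w∣f (suc i) = subst (_∣ prodF f) (identity w (w ^ s) (f (suc i)))
  (*-pres-∣ (w∣f zero) (^-*-∣-prodF (f ∘ suc) (w∣f ∘ suc) i))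
  where
  identity : ∀ w p x → w * (p * x) ≡ w * p * x
  identity = solve-∀

gcdF-∣ : ∀ {s} (f : Fin s → ℕ) i → gcdF f ∣ f i
gcdF-∣ f zero    = gcd[m,n]∣m _ _
gcdF-∣ f (suc i) = ∣-trans (gcd[m,n]∣n (f zero) _) (gcdF-∣ (f ∘ suc) i)

sumF-≤ : ∀ {s} (f : Fin s → ℕ) {b} → (∀ i → f i ≤ b) → sumF f ≤ s * b
sumF-≤ {zero}  f f≤b = z≤n
sumF-≤ {suc s} f f≤b = +-mono-≤ (f≤b zero) (sumF-≤ (f ∘ suc) (f≤b ∘ suc))

maxIndex : ∀ {s} (f : Fin (suc s) → ℕ) → ∃[ m ] ∀ i → f i ≤ f m
maxIndex {zero}  f = zero , λ { zero → ≤-refl }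
maxIndex {suc s} f with maxIndex (f ∘ suc)
... | m , f∘suc≤ with ≤-total (f zero) (f (suc m))
...   | inj₁ f0≤ = suc m , λ { zero → f0≤ ; (suc i) → f∘suc≤ i }
...   | inj₂ ≤f0 = zero , λ { zero → ≤-refl ; (suc i) → ≤-trans (f∘suc≤ i) ≤f0 }

2+k<3^[1+k] : ∀ k → 2 + k < 3 ^ suc k
2+k<3^[1+k] zero    = s≤s (s≤s (s≤s z≤n))
2+k<3^[1+k] (suc k) =
  ≤-trans (+-mono-≤ (m^n>0 3 (suc k)) (2+k<3^[1+k] k)) (+-monoʳ-≤ (3 ^ suc k) (m≤m+n _ _))

mersenne-∣-prodF⇒∣ : ∀ {s n} (e : Fin s → ℕ) → (∀ i → 0 < e i) →
                     prodF (mersenne ∘ e) ∣ mersenne n → ∀ i → e i ∣ n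
mersenne-∣-prodF⇒∣ e e>0 ∏∣ i = mersenne-∣⇒∣ (e>0 i) (∣-trans (∣-prodF (mersenne ∘ e) i) ∏∣)

no-common-divisor : ∀ {s} d (e : Fin (2 + s) → ℕ) → (∀ i → 0 < e i) →
                    prodF (mersenne ∘ e) ∣ mersenne (sumF e) → ¬ (∀ i → 2 + d ∣ e i)
no-common-divisor {s} d e e>0 ∏∣ 2+d∣e = <⇒≱ (2+k<3^[1+k] s)
  (≤-trans (^-monoˡ-≤ (suc s) 3≤w) (≤-trans (∣⇒≤ w^[1+s]∣t) t≤2+s))
  where
  open OddModulus (mersenne (suc d))

  3≤w : 3 ≤ w
  3≤w = s≤s (*-monoʳ-≤ 2 (mersenne-pos {suc d} z<s))

  w∣M[e] : ∀ i → w ∣ mersenne (e i)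
  w∣M[e] i = subst (_∣ mersenne (e i)) (mersenne-suc (suc d)) (mersenne-∣-mersenne (2+d∣e i))

  m : Fin (2 + s)
  m = proj₁ (maxIndex e)

  E Y : ℕ
  E = e m
  Y = mersenne E

  instance
    Y≢0 : NonZero Y
    Y≢0 = >-nonZero (mersenne-pos (e>0 m))
    E≢0 : NonZero E
    E≢0 = >-nonZero (e>0 m)
    n≢0 : NonZero (sumF e)
    n≢0 = >-nonZero (≤-trans (e>0 zero) (m≤m+n _ _))

  E∣n : E ∣ sumF e
  E∣n = mersenne-∣-prodF⇒∣ e e>0 ∏∣ m

  t : ℕ
  t = quotient E∣n

  n≡tE : sumF e ≡ t * E
  n≡tE = m∣n⇒n≡quotient*m E∣n

  instance
    t≢0 : NonZero t
    t≢0 = quotient≢0 E∣n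

  Y≡wc : Y ≡ w * quotient (w∣M[e] m)
  Y≡wc = trans (m∣n⇒n≡quotient*m (w∣M[e] m)) (*-comm _ w)

  M[n]≡gY : mersenne (sumF e) ≡ geomSum (1 + Y) t * Y
  M[n]≡gY = trans (cong mersenne (trans n≡tE (*-comm t E))) (mersenne-* E t)

  w^[1+s]∣t : w ^ suc s ∣ t
  w^[1+s]∣t = ^-∣-geomSum⇒^-∣ (suc s) t (subst (λ y → w ^ suc s ∣ geomSum (1 + y) t) Y≡wc
    (*-cancelʳ-∣ Y (subst (w ^ suc s * Y ∣_) M[n]≡gY (∣-trans (^-*-∣-prodF (mersenne ∘ e) w∣M[e] m) ∏∣))))

  t≤2+s : t ≤ 2 + s
  t≤2+s = *-cancelʳ-≤ t (2 + s) E (subst (_≤ (2 + s) * E) n≡tE (sumF-≤ e (proj₂ (maxIndex e))))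

lemma3p2 : (n s : ℕ) → 2 ≤ n → 2 ≤ s → (e : Fin s → ℕ) →
           (∀ i → 0 < e i) → sumF e ≡ n →
           prodF (λ i → mersenne (e i)) ∣ mersenne n →
           (∀ i → e i ∣ n) × gcdF e ≡ 1
lemma3p2 _ 1 _ (s≤s ())
lemma3p2 .(sumF e) (suc (suc s)) _ _ e e>0 refl ∏∣ = mersenne-∣-prodF⇒∣ e e>0 ∏∣ , gcd≡1
  where
  gcd≡1 : gcdF e ≡ 1
  gcd≡1 with gcdF e | gcdF-∣ e
  ... | 0           | 0∣e  = contradiction (0∣⇒≡0 (0∣e zero)) (≢-nonZero⁻¹ _ {{>-nonZero (e>0 zero)}})
  ... | 1           | _    = refl
  ... | suc (suc d) | d∣e  = contradiction d∣e (no-common-divisor d e e>0 ∏∣)
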